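{- For every graph $H$, it holds that $c^*(H)\leq\Delta(H)+1$.
   Context: Graphs may have loops; $N(v)$ is the neighborhood of $v$ and $\deg(v)=|N(v)|$ (a loop contributes 1); $\Delta(H)$ is the maximum degree of $H$. A set $S$ has a common neighbor in $L$ if some vertex of $L$ is adjacent to all vertices of $S$. $c^*(H)$ is the maximum over $L\subseteq V(H)$ of the largest size of an inclusion-minimal $S\subseteq V(H)$ without a common neighbor in $L$. -}

module Defs where

open import Data.Nat using (ℕ; _⊔_)
open import Data.Bool using (Bool; true)
open import Data.Fin using (Fin)
open import Data.Fin.Subset using (Subset; _∈_; _⊂_; ∣_∣)
open import Data.Vec using (tabulate; foldr′; allFin)
open import Data.Product using (Σ; ∃; _×_)
open import Relation.Nullary using (¬_)
open import Relation.Binary.PropositionalEquality using (_≡_)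

-- A finite (undirected) graph, loops allowed, on vertex set Fin n,
-- given by a symmetric Boolean adjacency relation.
record Graph : Set where
  field
    n   : ℕ
    adj : Fin n → Fin n → Bool
    sym : ∀ u v → adj u v ≡ adj v u

open Graph public

V : Graph → Set
V H = Fin (n H)

Adj : (H : Graph) → V H → V H → Set
Adj H u v = adj H u v ≡ true

N : (H : Graph) → V H → Subset (n H)
N H v = tabulate (adj H v)

-- deg(v) = |N(v)|  (a loop contributes 1).
deg : (H : Graph) → V H → ℕ
deg H v = ∣ N H v ∣

Δ : Graph → ℕ
Δ H = foldr′ (λ v m → deg H v ⊔ m) 0 (allFin (n H))

HasCommonNbrIn : (H : Graph) → Subset (n H) → Subset (n H) → Set
HasCommonNbrIn H L S = Σ (V H) λ u → u ∈ L × (∀ v → v ∈ S → Adj H u v)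

MinimalNoCommonNbr : (H : Graph) → Subset (n H) → Subset (n H) → Set
MinimalNoCommonNbr H L S =
  ¬ HasCommonNbrIn H L S × (∀ S′ → S′ ⊂ S → HasCommonNbrIn H L S′)

-- Minimality is only needed once: removing any vertex v from a nonempty S
-- leaves a set with a common neighbour u, so S - v ⊆ N(u) and therefore
-- |S| ≤ |S - v| + 1 ≤ deg(u) + 1 ≤ Δ(H) + 1.
module Submission where

open import Defs hiding (sym)
open import Data.Nat using (ℕ; suc; _≤_; _+_; _⊔_; s≤s; z≤n)
open import Data.Nat.Properties
  using (≤-reflexive; ≤-trans; n≤1+n; m≤m⊔n; m≤n⊔m; +-comm; module ≤-Reasoning)
open import Data.Fin using (Fin; zero; suc)
open import Data.Fin.Subset using (Subset; ∣_∣; _-_; _─_; _⊆_; outside; inside; ⊥)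
open import Data.Fin.Subset.Properties
  using (p─⊥≡p; p⊆q⇒∣p∣≤∣q∣; x∈p⇒p-x⊂p; nonempty?; Empty-unique; ∣⊥∣≡0)
open import Data.Vec using (Vec; _∷_; foldr′)
open import Data.Vec.Properties using (lookup⇒[]=; lookup∘tabulate)
open import Data.Vec.Membership.Propositional using () renaming (_∈_ to _∈ᵥ_)
open import Data.Vec.Membership.Propositional.Properties using (∈-allFin⁺)
open import Data.Vec.Relation.Unary.Any using (here; there)
open import Data.Product using (_,_)
open import Relation.Nullary using (yes; no)
open import Relation.Binary.PropositionalEquality using (_≡_; refl; sym; trans; cong)

∣p∣≤∣p─⊥∣ : ∀ {m} (p : Subset m) → ∣ p ∣ ≤ ∣ p ─ ⊥ ∣
∣p∣≤∣p─⊥∣ p = ≤-reflexive (cong ∣_∣ (sym (p─⊥≡p p)))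

∣p∣≤1+∣p-x∣ : ∀ {m} (p : Subset m) (x : Fin m) → ∣ p ∣ ≤ suc ∣ p - x ∣
∣p∣≤1+∣p-x∣ (outside ∷ p) zero    = ≤-trans (n≤1+n ∣ p ∣) (s≤s (∣p∣≤∣p─⊥∣ p))
∣p∣≤1+∣p-x∣ (inside  ∷ p) zero    = s≤s (∣p∣≤∣p─⊥∣ p)
∣p∣≤1+∣p-x∣ (outside ∷ p) (suc x) = ∣p∣≤1+∣p-x∣ p x
∣p∣≤1+∣p-x∣ (inside  ∷ p) (suc x) = s≤s (∣p∣≤1+∣p-x∣ p x)

∈⇒≤foldr-⊔ : ∀ {A : Set} {k} (f : A → ℕ) {xs : Vec A k} {x : A} →
             x ∈ᵥ xs → f x ≤ foldr′ (λ y r → f y ⊔ r) 0 xs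
∈⇒≤foldr-⊔ f {y ∷ _} (here refl) = m≤m⊔n (f y) _
∈⇒≤foldr-⊔ f {y ∷ _} (there x∈) = ≤-trans (∈⇒≤foldr-⊔ f x∈) (m≤n⊔m (f y) _)

deg≤Δ : (H : Graph) (u : V H) → deg H u ≤ Δ H
deg≤Δ H u = ∈⇒≤foldr-⊔ (deg H) (∈-allFin⁺ u)

commonNbr⇒∣S∣≤Δ : (H : Graph) (L S : Subset (n H)) → HasCommonNbrIn H L S → ∣ S ∣ ≤ Δ H
commonNbr⇒∣S∣≤Δ H L S (u , _ , adjAll) = ≤-trans (p⊆q⇒∣p∣≤∣q∣ S⊆N) (deg≤Δ H u)
  where
  S⊆N : S ⊆ N H u
  S⊆N {w} w∈S = lookup⇒[]= w (N H u) (trans (lookup∘tabulate (adj H u) w) (adjAll w w∈S))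

lemma14 : (H : Graph) → (L S : Subset (n H)) → MinimalNoCommonNbr H L S → ∣ S ∣ ≤ Δ H + 1
lemma14 H L S (_ , minimal) with nonempty? S
... | no S-empty = ≤-trans (≤-reflexive ∣S∣≡0) z≤n
  where
  ∣S∣≡0 : ∣ S ∣ ≡ 0
  ∣S∣≡0 = trans (cong ∣_∣ (Empty-unique S-empty)) (∣⊥∣≡0 (n H))
... | yes (v , v∈S) = begin
  ∣ S ∣           ≤⟨ ∣p∣≤1+∣p-x∣ S v ⟩
  suc ∣ S - v ∣   ≤⟨ s≤s (commonNbr⇒∣S∣≤Δ H L (S - v) (minimal (S - v) (x∈p⇒p-x⊂p v∈S))) ⟩
  suc (Δ H)       ≡⟨ +-comm 1 (Δ H) ⟩
  Δ H + 1         ∎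
  where open ≤-Reasoning
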